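{- For $n\geq 0$, $$F_{2n+1}^I(x,y,q)=\sum_{j=0}^{n}x\,y^j q^{4nj-2j^2+2n-2j}F_{2n-2j}^I(x,y,q).$$
   Context: $S_n(123,132,213)$ is the set of permutations of $[n]$ with no subsequence order isomorphic to $123$, $132$ or $213$; each such $\pi$ is a concatenation of increasing blocks of size $1$ or $2$, each block larger than all later blocks. $s(\pi)$, $d(\pi)$ are the numbers of maximal increasing runs of $\pi$ of length $1$ and $2$, and $inv(\pi)$ is the number of inversions. $F_n^I(x,y,q)=\sum_{\pi\in S_n(123,132,213)}x^{s(\pi)}y^{d(\pi)}q^{inv(\pi)}$ (so $F_0^I=1$). -}

module Defs where

open import Level using (Level)
open import Data.Bool using (Bool; true; false; _∧_; _∨_; not; if_then_else_)
open import Data.Nat using (ℕ; zero; suc; _<ᵇ_; _≡ᵇ_)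
open import Data.List using (List; []; _∷_; map; concatMap; filterᵇ; length; upTo; foldr)
open import Data.Bool.ListAction using (all; any)
open import Data.Product using (_×_; _,_)
open import Algebra.Bundles using (CommutativeSemiring)

words : ℕ → ℕ → List (List ℕ)
words n zero    = [] ∷ []
words n (suc k) = concatMap (λ a → map (a ∷_) (words n k)) (map suc (upTo n))

distinct : List ℕ → Bool
distinct []       = true
distinct (a ∷ as) = not (any (a ≡ᵇ_) as) ∧ distinct as

perms : ℕ → List (List ℕ)
perms n = filterᵇ distinct (words n n)

pairs : List ℕ → List (ℕ × ℕ)
pairs []       = []
pairs (a ∷ as) = map (a ,_) as Data.List.++ pairs as

triples : List ℕ → List (ℕ × ℕ × ℕ)
triples []       = []
triples (a ∷ as) = map (λ { (b , c) → (a , b , c) }) (pairs as) Data.List.++ triples as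

bad : ℕ × ℕ × ℕ → Bool
bad (a , b , c) = ((a <ᵇ b) ∧ (b <ᵇ c))
                ∨ ((a <ᵇ c) ∧ (c <ᵇ b))
                ∨ ((b <ᵇ a) ∧ (a <ᵇ c))

avoids : List ℕ → Bool
avoids π = all (λ t → not (bad t)) (triples π)

Sav : ℕ → List (List ℕ)
Sav n = filterᵇ avoids (perms n)

-- Lengths of the maximal increasing runs of a word.
-- runsAux cur len rest : the current run ends with cur and has length len.
runsAux : ℕ → ℕ → List ℕ → List ℕ
runsAux cur len []       = len ∷ []
runsAux cur len (b ∷ bs) = if cur <ᵇ b then runsAux b (suc len) bs
                                       else len ∷ runsAux b 1 bs

runs : List ℕ → List ℕ
runs []       = []
runs (a ∷ as) = runsAux a 1 as

count : {A : Set} → (A → Bool) → List A → ℕ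
count p xs = length (filterᵇ p xs)

sstat : List ℕ → ℕ
sstat π = count (_≡ᵇ 1) (runs π)

dstat : List ℕ → ℕ
dstat π = count (_≡ᵇ 2) (runs π)

inv : List ℕ → ℕ
inv π = count (λ { (a , b) → b <ᵇ a }) (pairs π)

module _ {c ℓ : Level} (R : CommutativeSemiring c ℓ) where
  open CommutativeSemiring R

  pow : Carrier → ℕ → Carrier
  pow a zero    = 1#
  pow a (suc k) = a * pow a k

  sumR : List Carrier → Carrier
  sumR = foldr _+_ 0#

  FI : ℕ → Carrier → Carrier → Carrier → Carrier
  FI n x y q = sumR (map (λ π → pow x (sstat π) * pow y (dstat π) * pow q (inv π)) (Sav n))

module Submission where

-- The permutations avoiding 123, 132 and 213 are the layered permutations with layers of size 1 or 2:
-- the first layer of such a π ∈ S_m is either m or (m−1, m). Indeed m and m−1 both occur (pigeonhole),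
-- and every entry after the second position lies below the first entry, for otherwise the first two
-- entries and that one form a 123, 132 or 213. Stripping the first layer gives
--   F_{m+2} = x q^{m+1} F_{m+1} + y q^{2m} F_m,
-- since a top singleton is a run of length 1 inverting with the m+1 later entries, and a top pair is a
-- run of length 2 whose two entries each invert with the m later entries. For m = 2n+1 the first summand
-- is the j = 0 term of the formula for F_{2n+3}, and substituting the formula for F_{2n+1} into the
-- second summand shifts j by one, so the theorem follows by induction on n.

open import Defs
open import Level using (Level)
open import Algebra.Bundles using (CommutativeSemiring)
import Algebra.Solver.CommutativeMonoid as CommutativeMonoidSolver
open import Data.Bool using (Bool; true; false; T; not; _∧_)
open import Data.Bool.Properties using (T-∧; T-∨; T-≡; T-not-≡; T?)
open import Data.Bool.ListAction using (any)
open import Data.Empty using (⊥)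
open import Data.Nat using (ℕ; zero; suc; _+_; _*_; _∸_; _≤_; _<_; z≤n; s≤s; _<ᵇ_; _≡ᵇ_)
open import Data.Nat.Properties
  using (≡ᵇ⇒≡; ≡⇒≡ᵇ; <ᵇ⇒<; <⇒<ᵇ; suc-injective; _≟_; <-cmp; ≤-refl; ≤-reflexive; ≤-pred; <-trans;
         <-asym; <-irrefl; <⇒≢; >⇒≢; <⇒≱; <⇒≯; ≤∧≢⇒<; m≤n⇒m≤1+n; n≤1+n; n<1+n; m+n∸m≡n;
         m≤n⇒∃[o]m+o≡n; *-suc; +-comm)
import Data.Nat.Properties as ℕ
open import Data.Nat.Tactic.RingSolver using (solve-∀)
open import Data.Product using (_×_; _,_; proj₂; ∃-syntax; uncurry)
open import Data.Sum using (_⊎_; inj₁; inj₂)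
open import Data.List
  using (List; []; _∷_; _++_; length; map; filterᵇ; upTo; concatMap; cartesianProductWith)
open import Data.List.Properties
  using (∷-injective; ∷-injectiveˡ; ∷-injectiveʳ; length-map; length-upTo; length-++; length-++-sucʳ;
         filter-++; filter-all; filter-reject; map-∘; map-applyUpTo)
open import Data.List.Relation.Unary.All as All using (All; []; _∷_)
open import Data.List.Relation.Unary.All.Properties using (all⁺; all⁻; ¬Any⇒All¬; All¬⇒¬Any; ++⁺; ++⁻ʳ; map⁺)
open import Data.List.Relation.Unary.Any as Any using (here; there)
open import Data.List.Relation.Unary.Any.Properties using (any⁺; any⁻)
open import Data.List.Relation.Unary.AllPairs using ([]; _∷_)
open import Data.List.Relation.Unary.Unique.Propositional using (Unique)
import Data.List.Relation.Unary.Unique.Propositional.Properties as Unique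
open import Data.List.Membership.Propositional using (_∈_)
open import Data.List.Membership.Propositional.Properties
open import Data.List.Membership.Propositional.Properties.WithK using (unique∧set⇒bag)
open import Data.List.Relation.Binary.Subset.Propositional using (_⊆_)
open import Data.List.Relation.Binary.BagAndSetEquality using (∼bag⇒↭)
open import Data.List.Relation.Binary.Permutation.Propositional using (_↭_; ↭⇒↭ₛ′)
import Data.List.Relation.Binary.Permutation.Propositional.Properties as Permutation
import Data.List.Relation.Binary.Permutation.Setoid.Properties as PermutationSetoid
open import Function using (_∘_; id; _⇔_; mk⇔; Equivalence)
open import Relation.Binary.Definitions using (DecidableEquality; tri<; tri≈; tri>)
open import Relation.Binary.PropositionalEquality
  using (_≡_; _≢_; refl; sym; trans; cong; cong₂; subst; ≢-sym; module ≡-Reasoning)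
open import Relation.Nullary using (¬_; yes; no; contradiction)

open Equivalence using (to; from)

T-not : ∀ {b} → T (not b) ⇔ (¬ T b)
T-not {true}  = mk⇔ (λ ()) (λ ¬t → ¬t _)
T-not {false} = mk⇔ (λ _ ()) (λ _ → _)

T-any-≡ᵇ : ∀ {a} as → T (any (a ≡ᵇ_) as) ⇔ (a ∈ as)
T-any-≡ᵇ {a} as = mk⇔ (Any.map (≡ᵇ⇒≡ a _) ∘ any⁻ _ as) (any⁺ _ ∘ Any.map (≡⇒≡ᵇ a _))

distinct⇔Unique : ∀ xs → T (distinct xs) ⇔ Unique xs
distinct⇔Unique []       = mk⇔ (λ _ → []) (λ _ → _)
distinct⇔Unique (a ∷ as) = mk⇔ toUnique fromUnique
  where
  toUnique : T (distinct (a ∷ as)) → Unique (a ∷ as)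
  toUnique t = let fresh , rest = to T-∧ t in
    ¬Any⇒All¬ as (to T-not fresh ∘ from (T-any-≡ᵇ as)) ∷ to (distinct⇔Unique as) rest
  fromUnique : Unique (a ∷ as) → T (distinct (a ∷ as))
  fromUnique (fresh ∷ u) =
    from T-∧ (from T-not (All¬⇒¬Any fresh ∘ to (T-any-≡ᵇ as)) , from (distinct⇔Unique as) u)

InRange : ℕ → ℕ → Set
InRange n e = 1 ≤ e × e ≤ n

InRange-weaken : ∀ {m e} → InRange m e → InRange (suc m) e
InRange-weaken (pos , e≤m) = pos , m≤n⇒m≤1+n e≤m

InRange-strengthen : ∀ {m e} → InRange (suc m) e → suc m ≢ e → InRange m e
InRange-strengthen (pos , e≤1+m) 1+m≢e = pos , ≤-pred (≤∧≢⇒< e≤1+m (≢-sym 1+m≢e))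

InRange⇒< : ∀ {m e} → InRange m e → e < suc m
InRange⇒< (_ , e≤m) = s≤s e≤m

∈-alphabet : ∀ {n e} → e ∈ map suc (upTo n) ⇔ InRange n e
∈-alphabet {n} = mk⇔ inRange member
  where
  inRange : ∀ {e} → e ∈ map suc (upTo n) → InRange n e
  inRange e∈ with _ , i∈ , refl ← ∈-map⁻ suc e∈ = s≤s z≤n , ∈-upTo⁻ i∈
  member : ∀ {e} → InRange n e → e ∈ map suc (upTo n)
  member {suc i} (_ , i<n) = ∈-map⁺ suc (∈-upTo⁺ i<n)

concatMap-∷≡cartesianProductWith : ∀ {A : Set} (as : List A) (ws : List (List A)) →
  concatMap (λ a → map (a ∷_) ws) as ≡ cartesianProductWith _∷_ as ws
concatMap-∷≡cartesianProductWith []       ws = refl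
concatMap-∷≡cartesianProductWith (a ∷ as) ws =
  cong (map (a ∷_) ws ++_) (concatMap-∷≡cartesianProductWith as ws)

words-suc : ∀ n k → words n (suc k) ≡ cartesianProductWith _∷_ (map suc (upTo n)) (words n k)
words-suc n k = concatMap-∷≡cartesianProductWith (map suc (upTo n)) (words n k)

∈-words⁻ : ∀ n k {π} → π ∈ words n k → length π ≡ k × All (InRange n) π
∈-words⁻ n zero    (here refl) = refl , []
∈-words⁻ n (suc k) π∈ with a , π , a∈ , π∈′ , refl ←
    ∈-cartesianProductWith⁻ _∷_ (map suc (upTo n)) (words n k) (subst (_ ∈_) (words-suc n k) π∈)
  = let len , rng = ∈-words⁻ n k π∈′ in cong suc len , to ∈-alphabet a∈ ∷ rng

∈-words⁺ : ∀ n k {π} → length π ≡ k → All (InRange n) π → π ∈ words n k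
∈-words⁺ n zero    {[]}    _   []         = here refl
∈-words⁺ n (suc k) {a ∷ π} len (ra ∷ rng) = subst (_ ∈_) (sym (words-suc n k))
  (∈-cartesianProductWith⁺ _∷_ (from ∈-alphabet ra) (∈-words⁺ n k (suc-injective len) rng))

words-unique : ∀ n k → Unique (words n k)
words-unique n zero    = [] ∷ []
words-unique n (suc k) = subst Unique (sym (words-suc n k))
  (Unique.cartesianProductWith⁺ _∷_ ∷-injective
    (Unique.map⁺ suc-injective (Unique.upTo⁺ n)) (words-unique n k))

record Avoider (m : ℕ) (π : List ℕ) : Set where
  constructor avoider
  field
    length≡     : length π ≡ m
    inRange     : All (InRange m) π
    unique      : Unique π
    patternFree : T (avoids π)

∈-Sav⁻ : ∀ m {π} → π ∈ Sav m → Avoider m π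
∈-Sav⁻ m π∈ with π∈perms , av ← ∈-filter⁻ (T? ∘ avoids) π∈
            with π∈words , dist ← ∈-filter⁻ (T? ∘ distinct) π∈perms
  = let len , rng = ∈-words⁻ m m π∈words in avoider len rng (to (distinct⇔Unique _) dist) av

∈-Sav⁺ : ∀ m {π} → Avoider m π → π ∈ Sav m
∈-Sav⁺ m (avoider len rng u av) = ∈-filter⁺ (T? ∘ avoids)
  (∈-filter⁺ (T? ∘ distinct) (∈-words⁺ m m len rng) (from (distinct⇔Unique _) u)) av

Sav-unique : ∀ m → Unique (Sav m)
Sav-unique m = Unique.filter⁺ (T? ∘ avoids) (Unique.filter⁺ (T? ∘ distinct) (words-unique m m))

-- Pigeonhole

module _ {A : Set} where

  ∈-++-∷⁻ : ∀ (as : List A) {y bs x} → x ∈ as ++ y ∷ bs → x ≢ y → x ∈ as ++ bs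
  ∈-++-∷⁻ as x∈ x≢y with ∈-++⁻ as x∈
  ... | inj₁ x∈as         = ∈-++⁺ˡ x∈as
  ... | inj₂ (here x≡y)   = contradiction x≡y x≢y
  ... | inj₂ (there x∈bs) = ∈-++⁺ʳ as x∈bs

  Unique∧⊆⇒length≤ : ∀ {xs ys : List A} → Unique xs → xs ⊆ ys → length xs ≤ length ys
  Unique∧⊆⇒length≤ {[]}     _           _   = z≤n
  Unique∧⊆⇒length≤ {x ∷ xs} (fresh ∷ u) sub with as , bs , refl ← ∈-∃++ (sub (here refl)) =
    subst (suc (length xs) ≤_) (sym (length-++-sucʳ as x bs))
      (s≤s (Unique∧⊆⇒length≤ u λ e∈ → ∈-++-∷⁻ as (sub (there e∈)) (≢-sym (All.lookup fresh e∈))))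

module _ {A : Set} (_≟ᴬ_ : DecidableEquality A) where
  open import Data.List.Membership.DecPropositional _≟ᴬ_ using (_∈?_)

  Unique∧⊆∧length≥⇒⊇ : ∀ {xs ys : List A} → Unique xs → xs ⊆ ys → length ys ≤ length xs → ys ⊆ xs
  Unique∧⊆∧length≥⇒⊇ {xs} u sub long {y} y∈ with y ∈? xs
  ... | yes y∈xs = y∈xs
  ... | no  y∉xs with as , bs , refl ← ∈-∃++ y∈ = contradiction long (<⇒≱ short)
    where
    short : length xs < length (as ++ y ∷ bs)
    short = subst (length xs <_) (sym (length-++-sucʳ as y bs))
      (s≤s (Unique∧⊆⇒length≤ u (λ x∈ → ∈-++-∷⁻ as (sub x∈) (λ { refl → y∉xs x∈ }))))

avoider-contains : ∀ {m π e} → Avoider m π → InRange m e → e ∈ π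
avoider-contains {m} (avoider len rng u _) e∈ =
  Unique∧⊆∧length≥⇒⊇ _≟_ u (from ∈-alphabet ∘ All.lookup rng)
    (≤-reflexive (trans (trans (length-map suc (upTo m)) (length-upTo m)) (sym len)))
    (from ∈-alphabet e∈)

bad-123 : ∀ {a b c} → a < b → b < c → T (bad (a , b , c))
bad-123 a<b b<c = from T-∨ (inj₁ (from T-∧ (<⇒<ᵇ a<b , <⇒<ᵇ b<c)))

bad-132 : ∀ {a b c} → a < c → c < b → T (bad (a , b , c))
bad-132 {a} {b} {c} a<c c<b =
  from (T-∨ {(a <ᵇ b) ∧ (b <ᵇ c)}) (inj₂ (from T-∨ (inj₁ (from T-∧ (<⇒<ᵇ a<c , <⇒<ᵇ c<b)))))

bad-213 : ∀ {a b c} → b < a → a < c → T (bad (a , b , c))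
bad-213 {a} {b} {c} b<a a<c = from (T-∨ {(a <ᵇ b) ∧ (b <ᵇ c)})
  (inj₂ (from (T-∨ {(a <ᵇ c) ∧ (c <ᵇ b)}) (inj₂ (from T-∧ (<⇒<ᵇ b<a , <⇒<ᵇ a<c)))))

bad⇒first<last : ∀ a b c → T (bad (a , b , c)) → a < c
bad⇒first<last a b c t with to T-∨ t
... | inj₁ p = let a<b , b<c = to T-∧ p in <-trans (<ᵇ⇒< a b a<b) (<ᵇ⇒< b c b<c)
... | inj₂ p with to T-∨ p
...   | inj₁ q = let a<c , _ = to T-∧ q in <ᵇ⇒< a c a<c
...   | inj₂ q = let _ , a<c = to T-∧ q in <ᵇ⇒< a c a<c

first<last⇒bad : ∀ {a b c} → a ≢ b → b ≢ c → a < c → T (bad (a , b , c))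
first<last⇒bad {a} {b} {c} a≢b b≢c a<c with <-cmp b c
... | tri≈ _ b≡c _ = contradiction b≡c b≢c
... | tri> _ _ c<b = bad-132 a<c c<b
... | tri< b<c _ _ with <-cmp a b
...   | tri< a<b _ _ = bad-123 a<b b<c
...   | tri≈ _ a≡b _ = contradiction a≡b a≢b
...   | tri> _ _ b<a = bad-213 b<a a<c

∈-triples : ∀ a b {c} rest → c ∈ rest → (a , b , c) ∈ triples (a ∷ b ∷ rest)
∈-triples a b rest c∈ = ∈-++⁺ˡ (∈-map⁺ _ (∈-++⁺ˡ (∈-map⁺ (b ,_) c∈)))

∈-pairs-∷⇒snd∈ : ∀ x π {b c} → (b , c) ∈ pairs (x ∷ π) → c ∈ π
∈-pairs-∷⇒snd∈ x π bc∈ with ∈-++⁻ (map (x ,_) π) bc∈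
∈-pairs-∷⇒snd∈ x π       bc∈ | inj₁ p with _ , c∈ , refl ← ∈-map⁻ (x ,_) p = c∈
∈-pairs-∷⇒snd∈ x (y ∷ π) bc∈ | inj₂ p = there (∈-pairs-∷⇒snd∈ y π p)

avoids⇒¬bad : ∀ {a b c rest} → T (avoids (a ∷ b ∷ rest)) → c ∈ rest → ¬ T (bad (a , b , c))
avoids⇒¬bad {a} {b} {rest = rest} av c∈ =
  to T-not (All.lookup (all⁺ _ _ av) (∈-triples a b rest c∈))

avoids⇒<head : ∀ {a b c rest} → T (avoids (a ∷ b ∷ rest)) →
  a ≢ b → c ∈ rest → a ≢ c → b ≢ c → c < a
avoids⇒<head {a} {b} {c} av a≢b c∈ a≢c b≢c with <-cmp c a
... | tri< c<a _ _ = c<a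
... | tri≈ _ c≡a _ = contradiction (sym c≡a) a≢c
... | tri> _ _ a<c = contradiction (first<last⇒bad a≢b b≢c a<c) (avoids⇒¬bad av c∈)

avoids-tail : ∀ a π → T (avoids (a ∷ π)) → T (avoids π)
avoids-tail a π av = all⁻ _ (++⁻ʳ (map _ (pairs π)) (all⁺ _ _ av))

avoids-∷-max-tail : ∀ {a x π} → All (_< a) π → T (avoids (x ∷ π)) → T (avoids (a ∷ x ∷ π))
avoids-∷-max-tail {a} {x} {π} below av = all⁻ _ (++⁺ (map⁺ (All.tabulate harmless)) (all⁺ _ _ av))
  where
  harmless : ∀ {bc} → bc ∈ pairs (x ∷ π) → T (not (bad (a , bc)))
  harmless {b , c} bc∈ =
    from T-not (<⇒≯ (All.lookup below (∈-pairs-∷⇒snd∈ x π bc∈)) ∘ bad⇒first<last a b c)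

avoids-∷-max : ∀ {a π} → All (_< a) π → T (avoids π) → T (avoids (a ∷ π))
avoids-∷-max {π = []}    _           _  = _
avoids-∷-max {π = x ∷ π} (_ ∷ below) av = avoids-∷-max-tail below av

-- Layered permutations

layered : ℕ → List (List ℕ)
layered zero          = [] ∷ []
layered (suc zero)    = (1 ∷ []) ∷ []
layered (suc (suc m)) = map (suc (suc m) ∷_) (layered (suc m))
                     ++ map (λ π → suc m ∷ suc (suc m) ∷ π) (layered m)

avoider-singleton-layer : ∀ {m π} → Avoider m π → Avoider (suc m) (suc m ∷ π)
avoider-singleton-layer (avoider len rng u av) = avoider
  (cong suc len)
  ((s≤s z≤n , ≤-refl) ∷ All.map InRange-weaken rng)
  (All.map (>⇒≢ ∘ InRange⇒<) rng ∷ u)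
  (avoids-∷-max (All.map InRange⇒< rng) av)

avoider-pair-layer : ∀ {m π} → Avoider m π → Avoider (suc (suc m)) (suc m ∷ suc (suc m) ∷ π)
avoider-pair-layer {m} (avoider len rng u av) = avoider
  (cong (suc ∘ suc) len)
  ((s≤s z≤n , n≤1+n (suc m)) ∷ (s≤s z≤n , ≤-refl) ∷ All.map (InRange-weaken ∘ InRange-weaken) rng)
  ((<⇒≢ (n<1+n (suc m)) ∷ All.map (>⇒≢ ∘ InRange⇒<) rng)
    ∷ All.map (>⇒≢ ∘ InRange⇒< ∘ InRange-weaken) rng ∷ u)
  (avoids-∷-max-tail (All.map InRange⇒< rng) (avoids-∷-max (All.map (InRange⇒< ∘ InRange-weaken) rng) av))

avoider-singleton-layer⁻ : ∀ {m π} → Avoider (suc m) (suc m ∷ π) → Avoider m π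
avoider-singleton-layer⁻ {m} {π} (avoider len (_ ∷ rng) (fresh ∷ u) av) = avoider
  (suc-injective len)
  (All.zipWith (uncurry InRange-strengthen) (rng , fresh))
  u (avoids-tail (suc m) π av)

avoider-pair-layer⁻ : ∀ {m π} → Avoider (suc (suc m)) (suc m ∷ suc (suc m) ∷ π) → Avoider m π
avoider-pair-layer⁻ {m} {π} (avoider len (_ ∷ _ ∷ rng) (fresh₁ ∷ fresh₂ ∷ u) av) = avoider
  (suc-injective (suc-injective len))
  (All.zipWith (uncurry InRange-strengthen)
    (All.zipWith (uncurry InRange-strengthen) (rng , fresh₂) , All.tail fresh₁))
  u (avoids-tail (suc (suc m)) π (avoids-tail (suc m) (suc (suc m) ∷ π) av))

avoider-rest<head : ∀ {m a b rest} → Avoider m (a ∷ b ∷ rest) → All (_< a) rest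
avoider-rest<head (avoider _ _ ((a≢b ∷ a≢rest) ∷ b≢rest ∷ _) av) =
  All.tabulate (λ c∈ → avoids⇒<head av a≢b c∈ (All.lookup a≢rest c∈) (All.lookup b≢rest c∈))

avoider-first-layer : ∀ {n π} → Avoider (suc (suc n)) π →
  (∃[ π′ ] π ≡ suc (suc n) ∷ π′ × Avoider (suc n) π′) ⊎
  (∃[ π′ ] π ≡ suc n ∷ suc (suc n) ∷ π′ × Avoider n π′)
avoider-first-layer {n} {a ∷ b ∷ rest} A@(avoider _ (ra ∷ _) ((a≢b ∷ _) ∷ _) _)
  with avoider-contains A (s≤s z≤n , ≤-refl)
... | here refl          = inj₁ (b ∷ rest , refl , avoider-singleton-layer⁻ A)
... | there (there top∈) = contradiction (proj₂ ra) (<⇒≱ (All.lookup (avoider-rest<head A) top∈))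
... | there (here refl) with avoider-contains A (s≤s z≤n , n≤1+n (suc n))
...   | here refl           = inj₂ (rest , refl , avoider-pair-layer⁻ A)
...   | there (here ())
...   | there (there next∈) = contradiction (proj₂ (InRange-strengthen ra (≢-sym a≢b)))
                                (<⇒≱ (All.lookup (avoider-rest<head A) next∈))

∈-layered⁻ : ∀ m {π} → π ∈ layered m → Avoider m π
∈-layered⁻ zero          (here refl) = avoider refl [] [] _
∈-layered⁻ (suc zero)    (here refl) = avoider-singleton-layer (∈-layered⁻ zero (here refl))
∈-layered⁻ (suc (suc m)) π∈ with ∈-++⁻ (map (suc (suc m) ∷_) (layered (suc m))) π∈
... | inj₁ p with _ , π′∈ , refl ← ∈-map⁻ _ p = avoider-singleton-layer (∈-layered⁻ (suc m) π′∈)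
... | inj₂ p with _ , π′∈ , refl ← ∈-map⁻ _ p = avoider-pair-layer (∈-layered⁻ m π′∈)

∈-layered⁺ : ∀ m {π} → Avoider m π → π ∈ layered m
∈-layered⁺ zero          {[]}               _                             = here refl
∈-layered⁺ (suc zero)    {suc zero ∷ []}    _                             = here refl
∈-layered⁺ (suc zero)    {zero ∷ []}        (avoider _ ((() , _) ∷ _) _ _)
∈-layered⁺ (suc zero)    {suc (suc _) ∷ []} (avoider _ ((_ , s≤s ()) ∷ _) _ _)
∈-layered⁺ (suc (suc m)) A with avoider-first-layer A
... | inj₁ (_ , refl , A′) = ∈-++⁺ˡ (∈-map⁺ _ (∈-layered⁺ (suc m) A′))
... | inj₂ (_ , refl , A′) =
  ∈-++⁺ʳ (map (suc (suc m) ∷_) (layered (suc m))) (∈-map⁺ _ (∈-layered⁺ m A′))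

layered-unique : ∀ m → Unique (layered m)
layered-unique zero          = [] ∷ []
layered-unique (suc zero)    = [] ∷ []
layered-unique (suc (suc m)) = Unique.++⁺
  (Unique.map⁺ ∷-injectiveʳ (layered-unique (suc m)))
  (Unique.map⁺ (∷-injectiveʳ ∘ ∷-injectiveʳ) (layered-unique m))
  heads-differ
  where
  heads-differ : ∀ {π} → π ∈ map (suc (suc m) ∷_) (layered (suc m))
                       × π ∈ map (λ π → suc m ∷ suc (suc m) ∷ π) (layered m) → ⊥
  heads-differ (p , q) with _ , _ , refl ← ∈-map⁻ _ p | _ , _ , eq ← ∈-map⁻ _ q =
    <-irrefl (sym (∷-injectiveˡ eq)) (n<1+n (suc m))

Sav↭layered : ∀ m → Sav m ↭ layered m
Sav↭layered m = ∼bag⇒↭ (unique∧set⇒bag (Sav-unique m) (layered-unique m)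
  (mk⇔ (∈-layered⁺ m ∘ ∈-Sav⁻ m) (∈-Sav⁺ m ∘ ∈-layered⁻ m)))

-- Statistics of a first layer

<⇒<ᵇ≡true : ∀ {m n} → m < n → (m <ᵇ n) ≡ true
<⇒<ᵇ≡true = to T-≡ ∘ <⇒<ᵇ

>⇒<ᵇ≡false : ∀ {m n} → n < m → (m <ᵇ n) ≡ false
>⇒<ᵇ≡false {m} {n} n<m = to T-not-≡ (from T-not (<-asym n<m ∘ <ᵇ⇒< m n))

runs-∷-max : ∀ {a π} → All (_< a) π → runs (a ∷ π) ≡ 1 ∷ runs π
runs-∷-max {π = []}    _         = refl
runs-∷-max {π = b ∷ π} (b<a ∷ _) rewrite >⇒<ᵇ≡false b<a = refl

runs-∷-ascent : ∀ {a b π} → a < b → All (_< b) π → runs (a ∷ b ∷ π) ≡ 2 ∷ runs π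
runs-∷-ascent {π = []}    a<b _         rewrite <⇒<ᵇ≡true a<b = refl
runs-∷-ascent {π = c ∷ π} a<b (c<b ∷ _) rewrite <⇒<ᵇ≡true a<b | >⇒<ᵇ≡false c<b = refl

count-++ : ∀ {A : Set} (p : A → Bool) xs ys → count p (xs ++ ys) ≡ count p xs + count p ys
count-++ p xs ys = trans (cong length (filter-++ (T? ∘ p) xs ys)) (length-++ (filterᵇ p xs))

count-map : ∀ {A B : Set} (p : B → Bool) (f : A → B) xs → count p (map f xs) ≡ count (p ∘ f) xs
count-map p f []       = refl
count-map p f (x ∷ xs) with p (f x)
... | true  = cong suc (count-map p f xs)
... | false = count-map p f xs

count-all : ∀ {A : Set} (p : A → Bool) {xs} → All (T ∘ p) xs → count p xs ≡ length xs
count-all p all-p = cong length (filter-all (T? ∘ p) all-p)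

inv-∷ : ∀ a π → inv (a ∷ π) ≡ count (_<ᵇ a) π + inv π
inv-∷ a π = trans (count-++ _ (map (a ,_) π) (pairs π)) (cong (_+ inv π) (count-map _ (a ,_) π))

inv-∷-max : ∀ {a π} → All (_< a) π → inv (a ∷ π) ≡ length π + inv π
inv-∷-max {a} {π} below = trans (inv-∷ a π) (cong (_+ inv π) (count-all (_<ᵇ a) (All.map <⇒<ᵇ below)))

inv-∷-ascent : ∀ {a b π} → a < b → All (_< a) π → inv (a ∷ b ∷ π) ≡ length π + length π + inv π
inv-∷-ascent {a} {b} {π} a<b below = begin
  inv (a ∷ b ∷ π)
    ≡⟨ inv-∷ a (b ∷ π) ⟩
  count (_<ᵇ a) (b ∷ π) + inv (b ∷ π)
    ≡⟨ cong (λ k → length k + inv (b ∷ π)) (filter-reject (T? ∘ (_<ᵇ a)) b≮a) ⟩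
  count (_<ᵇ a) π + inv (b ∷ π)
    ≡⟨ cong₂ _+_ (count-all (_<ᵇ a) (All.map <⇒<ᵇ below)) (inv-∷-max below-b) ⟩
  length π + (length π + inv π)
    ≡⟨ ℕ.+-assoc (length π) (length π) (inv π) ⟨
  length π + length π + inv π ∎
  where
  open ≡-Reasoning
  b≮a : ¬ T (b <ᵇ a)
  b≮a = <⇒≯ a<b ∘ <ᵇ⇒< b a
  below-b : All (_< b) π
  below-b = All.map (λ c<a → <-trans c<a a<b) below

statistics : List ℕ → ℕ × ℕ × ℕ
statistics π = sstat π , dstat π , inv π

statistics-∷-max : ∀ {a π} → All (_< a) π →
  statistics (a ∷ π) ≡ (suc (sstat π) , dstat π , length π + inv π)
statistics-∷-max below =
  cong₂ (λ r i → count (_≡ᵇ 1) r , count (_≡ᵇ 2) r , i) (runs-∷-max below) (inv-∷-max below)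

statistics-∷-ascent : ∀ {a b π} → a < b → All (_< a) π →
  statistics (a ∷ b ∷ π) ≡ (sstat π , suc (dstat π) , length π + length π + inv π)
statistics-∷-ascent a<b below = cong₂ (λ r i → count (_≡ᵇ 1) r , count (_≡ᵇ 2) r , i)
  (runs-∷-ascent a<b (All.map (λ c<a → <-trans c<a a<b) below)) (inv-∷-ascent a<b below)

-- The paper's 4nj − 2j² + 2n − 2j; the truncated subtraction is exact for the j ≤ n that occur.
qExponent : ℕ → ℕ → ℕ
qExponent n j = (4 * n * j + 2 * n) ∸ (2 * j * j + 2 * j)

qExponent-+ : ∀ j k → qExponent (j + k) j ≡ 2 * j * j + 4 * k * j + 2 * k
qExponent-+ j k = trans (cong (_∸ (2 * j * j + 2 * j)) (expand j k)) (m+n∸m≡n (2 * j * j + 2 * j) _)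
  where
  expand : ∀ j k → 4 * (j + k) * j + 2 * (j + k) ≡ (2 * j * j + 2 * j) + (2 * j * j + 4 * k * j + 2 * k)
  expand = solve-∀

qExponent-suc : ∀ {n j} → j ≤ n → qExponent (suc n) (suc j) ≡ (2 * n + 1) + (2 * n + 1) + qExponent n j
qExponent-suc {j = j} j≤n with k , refl ← m≤n⇒∃[o]m+o≡n j≤n = begin
  qExponent (suc j + k) (suc j)                        ≡⟨ qExponent-+ (suc j) k ⟩
  2 * suc j * suc j + 4 * k * suc j + 2 * k            ≡⟨ expand j k ⟩
  o + o + (2 * j * j + 4 * k * j + 2 * k)              ≡⟨ cong (o + o +_) (qExponent-+ j k) ⟨
  o + o + qExponent (j + k) j                          ∎
  where
  open ≡-Reasoning
  o : ℕ
  o = 2 * (j + k) + 1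
  expand : ∀ j k → 2 * suc j * suc j + 4 * k * suc j + 2 * k
                 ≡ (2 * (j + k) + 1) + (2 * (j + k) + 1) + (2 * j * j + 4 * k * j + 2 * k)
  expand = solve-∀

qExponent-zero : ∀ n → qExponent (suc n) 0 ≡ suc (2 * n + 1)
qExponent-zero = expand
  where
  expand : ∀ n → 4 * suc n * 0 + 2 * suc n ≡ suc (2 * n + 1)
  expand = solve-∀

module _ {c ℓ : Level} (R : CommutativeSemiring c ℓ) where
  open CommutativeSemiring R
    using (Carrier; _≈_; 0#; 1#; setoid; isEquivalence; +-isCommutativeMonoid; *-commutativeMonoid;
           +-cong; +-congˡ; +-identityˡ; +-identityʳ; +-assoc;
           *-cong; *-congˡ; *-congʳ; *-identityˡ; *-identityʳ; *-assoc; distribˡ; zeroʳ)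
    renaming (_+_ to _+ᴿ_; _*_ to _*ᴿ_; refl to ≈-refl; sym to ≈-sym; trans to ≈-trans)
  open import Relation.Binary.Reasoning.Setoid setoid

  ∑ : {A : Set} → (A → Carrier) → List A → Carrier
  ∑ f xs = sumR R (map f xs)

  ∑-++ : ∀ {A : Set} (f : A → Carrier) xs ys → ∑ f (xs ++ ys) ≈ ∑ f xs +ᴿ ∑ f ys
  ∑-++ f []       ys = ≈-sym (+-identityˡ _)
  ∑-++ f (x ∷ xs) ys = ≈-trans (+-congˡ (∑-++ f xs ys)) (≈-sym (+-assoc _ _ _))

  ∑-map : ∀ {A B : Set} (f : B → Carrier) (g : A → B) xs → ∑ f (map g xs) ≡ ∑ (f ∘ g) xs
  ∑-map f g xs = cong (sumR R) (sym (map-∘ xs))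

  ∑-cong : ∀ {A : Set} {f g : A → Carrier} xs → (∀ {a} → a ∈ xs → f a ≈ g a) → ∑ f xs ≈ ∑ g xs
  ∑-cong []       f≈g = ≈-refl
  ∑-cong (x ∷ xs) f≈g = +-cong (f≈g (here refl)) (∑-cong xs (f≈g ∘ there))

  ∑-*ˡ : ∀ {A : Set} k (f : A → Carrier) xs → ∑ (λ a → k *ᴿ f a) xs ≈ k *ᴿ ∑ f xs
  ∑-*ˡ k f []       = ≈-sym (zeroʳ k)
  ∑-*ˡ k f (x ∷ xs) = ≈-trans (+-congˡ (∑-*ˡ k f xs)) (≈-sym (distribˡ k _ _))

  ∑-↭ : ∀ {A : Set} (f : A → Carrier) {xs ys} → xs ↭ ys → ∑ f xs ≈ ∑ f ys
  ∑-↭ f xs↭ys = PermutationSetoid.foldr-commMonoid setoid +-isCommutativeMonoid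
    (↭⇒↭ₛ′ isEquivalence (Permutation.map⁺ f xs↭ys))

  ∑-upTo-suc : ∀ (g : ℕ → Carrier) k → ∑ g (upTo (suc k)) ≡ g 0 +ᴿ ∑ (g ∘ suc) (upTo k)
  ∑-upTo-suc g k = cong (λ gs → g 0 +ᴿ sumR R gs)
    (trans (map-applyUpTo suc g k) (sym (map-applyUpTo id (g ∘ suc) k)))

  pow-+ : ∀ a m n → pow R a (m + n) ≈ pow R a m *ᴿ pow R a n
  pow-+ a zero    n = ≈-sym (*-identityˡ _)
  pow-+ a (suc m) n = ≈-trans (*-congˡ (pow-+ a m n)) (≈-sym (*-assoc _ _ _))

  module _ (x y q : Carrier) where
    open CommutativeMonoidSolver *-commutativeMonoid using (solve; _⊜_; _⊕_)

    monomial : ℕ × ℕ × ℕ → Carrier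
    monomial (s , d , i) = pow R x s *ᴿ pow R y d *ᴿ pow R q i

    weight : List ℕ → Carrier
    weight π = monomial (statistics π)

    weight-∷-max : ∀ {a π} → All (_< a) π →
      weight (a ∷ π) ≈ x *ᴿ pow R q (length π) *ᴿ weight π
    weight-∷-max {a} {π} below = begin
      weight (a ∷ π)                           ≡⟨ cong monomial (statistics-∷-max below) ⟩
      x *ᴿ X *ᴿ Y *ᴿ pow R q (L + inv π)       ≈⟨ *-congˡ (pow-+ q L (inv π)) ⟩
      x *ᴿ X *ᴿ Y *ᴿ (pow R q L *ᴿ I)          ≈⟨ rearrange x X Y (pow R q L) I ⟩
      x *ᴿ pow R q L *ᴿ weight π               ∎
      where
      rearrange : ∀ x X Y Q I → x *ᴿ X *ᴿ Y *ᴿ (Q *ᴿ I) ≈ x *ᴿ Q *ᴿ (X *ᴿ Y *ᴿ I)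
      rearrange = solve 5 (λ x X Y Q I → ((x ⊕ X) ⊕ Y) ⊕ (Q ⊕ I) ⊜ (x ⊕ Q) ⊕ ((X ⊕ Y) ⊕ I)) ≈-refl
      L : ℕ
      L = length π
      X Y I : Carrier
      X = pow R x (sstat π)
      Y = pow R y (dstat π)
      I = pow R q (inv π)

    weight-∷-ascent : ∀ {a b π} → a < b → All (_< a) π →
      weight (a ∷ b ∷ π) ≈ y *ᴿ pow R q (length π + length π) *ᴿ weight π
    weight-∷-ascent {a} {b} {π} a<b below = begin
      weight (a ∷ b ∷ π)                       ≡⟨ cong monomial (statistics-∷-ascent a<b below) ⟩
      X *ᴿ (y *ᴿ Y) *ᴿ pow R q (L + inv π)     ≈⟨ *-congˡ (pow-+ q L (inv π)) ⟩
      X *ᴿ (y *ᴿ Y) *ᴿ (pow R q L *ᴿ I)        ≈⟨ rearrange y X Y (pow R q L) I ⟩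
      y *ᴿ pow R q L *ᴿ weight π               ∎
      where
      rearrange : ∀ y X Y Q I → X *ᴿ (y *ᴿ Y) *ᴿ (Q *ᴿ I) ≈ y *ᴿ Q *ᴿ (X *ᴿ Y *ᴿ I)
      rearrange = solve 5 (λ y X Y Q I → (X ⊕ (y ⊕ Y)) ⊕ (Q ⊕ I) ⊜ (y ⊕ Q) ⊕ ((X ⊕ Y) ⊕ I)) ≈-refl
      L : ℕ
      L = length π + length π
      X Y I : Carrier
      X = pow R x (sstat π)
      Y = pow R y (dstat π)
      I = pow R q (inv π)

    ∑-singleton-layer : ∀ m →
      ∑ weight (map (suc m ∷_) (layered m)) ≈ x *ᴿ pow R q m *ᴿ ∑ weight (layered m)
    ∑-singleton-layer m = begin
      ∑ weight (map (suc m ∷_) (layered m))              ≡⟨ ∑-map weight (suc m ∷_) (layered m) ⟩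
      ∑ (weight ∘ (suc m ∷_)) (layered m)                ≈⟨ ∑-cong (layered m) prepend ⟩
      ∑ (λ π → x *ᴿ pow R q m *ᴿ weight π) (layered m)   ≈⟨ ∑-*ˡ _ weight (layered m) ⟩
      x *ᴿ pow R q m *ᴿ ∑ weight (layered m)             ∎
      where
      prepend : ∀ {π} → π ∈ layered m → weight (suc m ∷ π) ≈ x *ᴿ pow R q m *ᴿ weight π
      prepend {π} π∈ with avoider len rng _ _ ← ∈-layered⁻ m π∈ =
        subst (λ l → weight (suc m ∷ π) ≈ x *ᴿ pow R q l *ᴿ weight π) len
          (weight-∷-max (All.map InRange⇒< rng))

    ∑-pair-layer : ∀ m →
      ∑ weight (map (λ π → suc m ∷ suc (suc m) ∷ π) (layered m)) ≈ y *ᴿ pow R q (m + m) *ᴿ ∑ weight (layered m)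
    ∑-pair-layer m = begin
      ∑ weight (map pair (layered m))                          ≡⟨ ∑-map weight pair (layered m) ⟩
      ∑ (weight ∘ pair) (layered m)                            ≈⟨ ∑-cong (layered m) prepend ⟩
      ∑ (λ π → y *ᴿ pow R q (m + m) *ᴿ weight π) (layered m)   ≈⟨ ∑-*ˡ _ weight (layered m) ⟩
      y *ᴿ pow R q (m + m) *ᴿ ∑ weight (layered m)             ∎
      where
      pair : List ℕ → List ℕ
      pair π = suc m ∷ suc (suc m) ∷ π
      prepend : ∀ {π} → π ∈ layered m → weight (pair π) ≈ y *ᴿ pow R q (m + m) *ᴿ weight π
      prepend {π} π∈ with avoider len rng _ _ ← ∈-layered⁻ m π∈ =
        subst (λ l → weight (pair π) ≈ y *ᴿ pow R q (l + l) *ᴿ weight π) len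
          (weight-∷-ascent (n<1+n (suc m)) (All.map InRange⇒< rng))

    FI≈∑layered : ∀ m → FI R m x y q ≈ ∑ weight (layered m)
    FI≈∑layered m = ∑-↭ weight (Sav↭layered m)

    FI-one : FI R 1 x y q ≈ x *ᴿ FI R 0 x y q
    FI-one = begin
      FI R 1 x y q                         ≈⟨ FI≈∑layered 1 ⟩
      ∑ weight (map (1 ∷_) (layered 0))    ≈⟨ ∑-singleton-layer 0 ⟩
      x *ᴿ 1# *ᴿ ∑ weight (layered 0)      ≈⟨ *-cong (*-identityʳ x) (≈-sym (FI≈∑layered 0)) ⟩
      x *ᴿ FI R 0 x y q                    ∎

    FI-recurrence : ∀ m → FI R (suc (suc m)) x y q
      ≈ x *ᴿ pow R q (suc m) *ᴿ FI R (suc m) x y q +ᴿ y *ᴿ pow R q (m + m) *ᴿ FI R m x y q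
    FI-recurrence m = begin
      FI R (suc (suc m)) x y q
        ≈⟨ FI≈∑layered (suc (suc m)) ⟩
      ∑ weight (singletons ++ pairs′)
        ≈⟨ ∑-++ weight singletons pairs′ ⟩
      ∑ weight singletons +ᴿ ∑ weight pairs′
        ≈⟨ +-cong (∑-singleton-layer (suc m)) (∑-pair-layer m) ⟩
      x *ᴿ pow R q (suc m) *ᴿ ∑ weight (layered (suc m)) +ᴿ y *ᴿ pow R q (m + m) *ᴿ ∑ weight (layered m)
        ≈⟨ +-cong (*-congˡ (FI≈∑layered (suc m))) (*-congˡ (FI≈∑layered m)) ⟨
      x *ᴿ pow R q (suc m) *ᴿ FI R (suc m) x y q +ᴿ y *ᴿ pow R q (m + m) *ᴿ FI R m x y q ∎
      where
      singletons pairs′ : List (List ℕ)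
      singletons = map (suc (suc m) ∷_) (layered (suc m))
      pairs′     = map (λ π → suc m ∷ suc (suc m) ∷ π) (layered m)

    module _ (f : ℕ → Carrier) where

      term : ℕ → ℕ → Carrier
      term n j = x *ᴿ pow R y j *ᴿ pow R q (qExponent n j) *ᴿ f (2 * n ∸ 2 * j)

      term-zero : ∀ n → x *ᴿ pow R q (suc (2 * n + 1)) *ᴿ f (suc (2 * n + 1)) ≈ term (suc n) 0
      term-zero n = begin
        x *ᴿ pow R q (suc (2 * n + 1)) *ᴿ f (suc (2 * n + 1))
          ≡⟨ cong₂ (λ e i → x *ᴿ pow R q e *ᴿ f i) (sym (qExponent-zero n)) (sym (double-suc n)) ⟩
        x *ᴿ pow R q (qExponent (suc n) 0) *ᴿ f (2 * suc n)
          ≈⟨ *-congʳ (*-congʳ (*-identityʳ x)) ⟨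
        term (suc n) 0 ∎
        where
        double-suc : ∀ n → 2 * suc n ≡ suc (2 * n + 1)
        double-suc = solve-∀

      term-suc : ∀ {n j} → j ≤ n →
        y *ᴿ pow R q ((2 * n + 1) + (2 * n + 1)) *ᴿ term n j ≈ term (suc n) (suc j)
      term-suc {n} {j} j≤n = begin
        y *ᴿ pow R q O *ᴿ (x *ᴿ Y *ᴿ E *ᴿ F)
          ≈⟨ rearrange y (pow R q O) x Y E F ⟩
        x *ᴿ (y *ᴿ Y) *ᴿ (pow R q O *ᴿ E) *ᴿ F
          ≈⟨ *-congʳ (*-congˡ (pow-+ q O (qExponent n j))) ⟨
        x *ᴿ (y *ᴿ Y) *ᴿ pow R q (O + qExponent n j) *ᴿ F
          ≡⟨ cong₂ (λ e i → x *ᴿ (y *ᴿ Y) *ᴿ pow R q e *ᴿ f i)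
                   (qExponent-suc j≤n) (cong₂ _∸_ (*-suc 2 n) (*-suc 2 j)) ⟨
        term (suc n) (suc j) ∎
        where
        rearrange : ∀ y Q x Y E F → y *ᴿ Q *ᴿ (x *ᴿ Y *ᴿ E *ᴿ F) ≈ x *ᴿ (y *ᴿ Y) *ᴿ (Q *ᴿ E) *ᴿ F
        rearrange = solve 6 (λ y Q x Y E F → (y ⊕ Q) ⊕ (((x ⊕ Y) ⊕ E) ⊕ F) ⊜ ((x ⊕ (y ⊕ Y)) ⊕ (Q ⊕ E)) ⊕ F) ≈-refl
        O : ℕ
        O = (2 * n + 1) + (2 * n + 1)
        Y E F : Carrier
        Y = pow R y j
        E = pow R q (qExponent n j)
        F = f (2 * n ∸ 2 * j)

      odd-closed-form :
        f 1 ≈ x *ᴿ f 0 →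
        (∀ m → f (suc (suc m)) ≈ x *ᴿ pow R q (suc m) *ᴿ f (suc m) +ᴿ y *ᴿ pow R q (m + m) *ᴿ f m) →
        ∀ n → f (2 * n + 1) ≈ ∑ (term n) (upTo (n + 1))
      odd-closed-form f-one f-rec zero = begin
        f 1               ≈⟨ f-one ⟩
        x *ᴿ f 0          ≈⟨ *-congʳ (≈-trans (*-identityʳ _) (*-identityʳ x)) ⟨
        term 0 0          ≈⟨ +-identityʳ _ ⟨
        term 0 0 +ᴿ 0#    ∎
      odd-closed-form f-one f-rec (suc n) = begin
        f (2 * suc n + 1)
          ≡⟨ cong (λ k → f (k + 1)) (*-suc 2 n) ⟩
        f (suc (suc o))
          ≈⟨ f-rec o ⟩
        x *ᴿ pow R q (suc o) *ᴿ f (suc o) +ᴿ y *ᴿ pow R q (o + o) *ᴿ f o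
          ≈⟨ +-cong (term-zero n) (*-congˡ (odd-closed-form f-one f-rec n)) ⟩
        term (suc n) 0 +ᴿ y *ᴿ pow R q (o + o) *ᴿ ∑ (term n) (upTo (n + 1))
          ≈⟨ +-congˡ (∑-*ˡ _ (term n) (upTo (n + 1))) ⟨
        term (suc n) 0 +ᴿ ∑ (λ j → y *ᴿ pow R q (o + o) *ᴿ term n j) (upTo (n + 1))
          ≈⟨ +-congˡ (∑-cong (upTo (n + 1)) (term-suc ∘ index≤n)) ⟩
        term (suc n) 0 +ᴿ ∑ (term (suc n) ∘ suc) (upTo (n + 1))
          ≡⟨ ∑-upTo-suc (term (suc n)) (n + 1) ⟨
        ∑ (term (suc n)) (upTo (suc n + 1)) ∎
        where
        o : ℕ
        o = 2 * n + 1
        index≤n : ∀ {j} → j ∈ upTo (n + 1) → j ≤ n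
        index≤n {j} j∈ = ≤-pred (subst (j <_) (+-comm n 1) (∈-upTo⁻ j∈))

theorem4p5 : {c ℓ : Level} (R : CommutativeSemiring c ℓ) (x y q : CommutativeSemiring.Carrier R) (n : ℕ) →
    CommutativeSemiring._≈_ R
    (FI R (2 * n + 1) x y q)
    (sumR R (map (λ j → CommutativeSemiring._*_ R (CommutativeSemiring._*_ R (CommutativeSemiring._*_ R x (pow R y j)) (pow R q ((4 * n * j + 2 * n) ∸ (2 * j * j + 2 * j)))) (FI R (2 * n ∸ 2 * j) x y q)) (upTo (n + 1))))
theorem4p5 R x y q =
  odd-closed-form R x y q (λ m → FI R m x y q) (FI-one R x y q) (FI-recurrence R x y q)
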